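{- Let $m\ge0$ and $n\ge1$ be integers and $k\ge0$, $i\ge1$. (i) If $f_{2k}+1\le n<f_{2k+2}-1$ and $\beta_i+1<n+m\le\beta_i+f_{2k+1}-1$, then $H_{m,n}=0$. (ii) If $f_{2k+1}+1\le n<f_{2k+2}-1$ and $\gamma_i-f_{2k}+1<n+m\le\gamma_i-1$, then $H_{m,n}=0$. (iii) If $f_{2k}+1\le n<f_{2k+3}-1$ and $\alpha_i-f_{2k+2}+1<n+m\le\alpha_i-1$, then $H_{m,n}=0$.
   Context: Let $\tau$ be the substitution on $\{0,1\}$ with $\tau(1)=101$, $\tau(0)=1$ (extended to words by concatenation), and let $\mathbf{s}=(s_j)_{j\ge 0}=\lim_{j\to\infty}\tau^j(1)$ be its fixed point beginning with $1$. For $m\ge 0$, $n\ge 1$, $H_{m,n}=\det(s_{m+i+j})_{0\le i,j\le n-1}$. Define $f_{2j}=|\tau^j(1)|$, $f_{2j+1}=|\tau^j(10)|$; equivalently $f_0=1$, $f_1=2$, $f_{2j+2}=f_{2j}+f_{2j+1}$, $f_{2j+3}=f_{2j}+f_{2j+2}$; the $f_{2j+1}$ are even. Every integer $n\ge0$ has a unique representation $n=\sum_{i\ge0}a_i(n)f_i$ with $a_i(n)\in\{0,1\}$, finitely many nonzero, $a_ia_{i+1}=0$ for all $i$, and $a_ia_{i+2}=0$ for all even $i$. For $k\ge0$ put $\Phi_k(n)=\sum_{i=0}^{2k+2}a_i(n)f_i$. Let $\mathbb{N}=\{0,1,\dots\}$. For $k\ge 0$ let $E'_{k}=\{x\in\mathbb{N}:\Phi_k(x)=f_{2k+3}/2\}$,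 $F_k=\{y\in\mathbb{N}:\Phi_k(y)=f_{2k+1}/2\}$, $F'_k=\{y\in\mathbb{N}:\Phi_{k+1}(y)=f_{2k+1}/2\}$, $F''_k=F_k\setminus F'_k$. For fixed $k$, let $(\alpha_i)_{i\ge1}$, $(\beta'_i)_{i\ge1}$, $(\gamma_i)_{i\ge1}$ be the increasing enumerations of $E'_{k+1}$, $F''_k$, $E'_k$ respectively, and $\beta_i=\beta'_i+f_{2k}$. -}

module Defs where

open import Data.Bool using (Bool; true; false; if_then_else_)
open import Data.Nat using (ℕ; zero; suc; _+_; _*_; _<_; ⌊_/2⌋)
open import Data.List using (List; []; _∷_; _++_; length; take; concatMap)
open import Data.Fin using (Fin; punchIn) renaming (zero to fz; suc to fs)
open import Data.Integer using (ℤ; +_; -_) renaming (_+_ to _+ℤ_; _*_ to _*ℤ_)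
open import Data.Product using (Σ; ∃; _×_; _,_)
open import Relation.Binary.PropositionalEquality using (_≡_)
open import Relation.Nullary using (¬_)

-- Letters: true = 1, false = 0.
τ₁ : Bool → List Bool
τ₁ true  = true ∷ false ∷ true ∷ []
τ₁ false = true ∷ []

τ : List Bool → List Bool
τ = concatMap τ₁

iter : ℕ → List Bool → List Bool
iter zero    w = w
iter (suc j) w = τ (iter j w)

-- j-th letter of a word (0-indexed), default 0 beyond the end
nth : List Bool → ℕ → Bool
nth []      _       = false
nth (b ∷ w) zero    = b
nth (b ∷ w) (suc i) = nth w i

-- s_j : the fixed point lim τ^j(1); τ^(j+1)(1) is a prefix of it of length > j
s : ℕ → ℤ
s j = if nth (iter (suc j) (true ∷ [])) j then + 1 else + 0

-- f_{2j} = |τ^j(1)|, f_{2j+1} = |τ^j(10)|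
fAux : ℕ → ℕ → ℕ
fAux j zero          = length (iter j (true ∷ []))
fAux j (suc zero)    = length (iter j (true ∷ false ∷ []))
fAux j (suc (suc i)) = fAux (suc j) i

f : ℕ → ℕ
f = fAux 0

sumSigned : ∀ {n} → (Fin n → ℤ) → ℤ
sumSigned {zero}  g = + 0
sumSigned {suc n} g = g fz +ℤ (- sumSigned (λ j → g (fs j)))

det : ∀ {n} → (Fin n → Fin n → ℤ) → ℤ
det {zero}  M = + 1
det {suc n} M =
  sumSigned (λ j → M fz j *ℤ det (λ r c → M (fs r) (punchIn j c)))

toN : ∀ {n} → Fin n → ℕ
toN fz     = 0
toN (fs i) = suc (toN i)

H : ℕ → ℕ → ℤ
H m n = det {n} (λ i j → s (m + toN i + toN j))

valFrom : ℕ → List Bool → ℕ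
valFrom i []      = 0
valFrom i (b ∷ d) = (if b then f i else 0) + valFrom (suc i) d

val : List Bool → ℕ
val = valFrom 0

Admissible : List Bool → Set
Admissible d =
  (∀ i → nth d i ≡ true → nth d (suc i) ≡ false) ×
  (∀ t → nth d (2 * t) ≡ true → nth d (2 * t + 2) ≡ false)

IsRep : ℕ → List Bool → Set
IsRep x d = Admissible d × val d ≡ x

PhiIs : ℕ → ℕ → ℕ → Set
PhiIs k x v = ∃ λ d → IsRep x d × val (take (2 * k + 3) d) ≡ v

E′ : ℕ → ℕ → Set
E′ k x = PhiIs k x ⌊ f (2 * k + 3) /2⌋

F : ℕ → ℕ → Set
F k y = PhiIs k y ⌊ f (2 * k + 1) /2⌋

F′ : ℕ → ℕ → Set
F′ k y = PhiIs (suc k) y ⌊ f (2 * k + 1) /2⌋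

F″ : ℕ → ℕ → Set
F″ k y = F k y × ¬ F′ k y

-- e is the increasing enumeration of S (0-indexed: e 0 is the first element)
Enumerates : (ℕ → Set) → (ℕ → ℕ) → Set
Enumerates S e =
  (∀ i → e i < e (suc i)) ×
  (∀ y → (S y → ∃ λ i → e i ≡ y) × ((∃ λ i → e i ≡ y) → S y))

-- Each vanishing region comes from two equal rows of the Hankel matrix. Put A k = τᵏ(1) and B k = τᵏ(0),
-- so A (k+1) = A k · B k · A k, |A k| = f_{2k} and |A k · B k| = f_{2k+1}. Both A k · B k and B k · A k
-- have the form P k · c c̄ · Q k, where Q k is the reversal of P k and |P k| = f_{2k+1}/2 − 1; as A k is a
-- palindrome, P k is a prefix and Q k a suffix of A k. Hence Q k · (A k)ʲ · P k has period f_{2k}, and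
-- Q k · A (k+1) · P k has period f_{2k+1}. If Φ_k(x) < f_{2k+2}, the prefix of s of length x − Φ_k(x) is
-- τᵏ⁺¹(u) for some u and is followed in s by A (k+1) · A k · P k. For x in F_k, E′_k and E′_{k+1} (the last
-- one at level k + 1) this puts Q k (A k)² P k, Q k A (k+1) P k and Q k (A k)³ P k into s right around x,
-- and the bounds on m and n say precisely that two rows of H_{m,n} one period apart read inside it.

module Submission where

open import Defs
open import Data.Bool using (Bool; true; false; not; if_then_else_)
open import Data.Bool.Properties using (not-involutive)
open import Data.Nat using (ℕ; zero; suc; _+_; _*_; _<_; _≤_; s≤s; z≤n; _≤?_; ⌊_/2⌋)
open import Data.Nat.Properties
open import Data.Nat.Tactic.RingSolver using (solve-∀)
open import Algebra.Properties.CommutativeSemigroup +-commutativeSemigroup using (xy∙z≈xz∙y)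
open import Data.Fin using (Fin; punchIn) renaming (zero to fz; suc to fs)
open import Data.Integer using (ℤ; 0ℤ; 1ℤ; +0; +[1+_]; -_; -[1+_]; _-_) renaming (_+_ to _+ℤ_; _*_ to _*ℤ_)
import Data.Integer.Properties as ℤP
open import Data.Integer.Tactic.RingSolver using () renaming (solve-∀ to solveℤ-∀)
open import Data.List using (List; []; _∷_; _++_; length; reverse; take; drop)
open import Data.List.Properties
  using (++-assoc; length-++; ++-identityʳ; unfold-reverse; reverse-++; length-reverse;
         ∷-injectiveˡ; ∷-injectiveʳ; ++-monoid)
open import Data.Product using (∃; _×_; _,_; proj₁; proj₂)
open import Relation.Binary.PropositionalEquality
open import Relation.Nullary using (yes; no; contradiction)
open import Algebra.Solver.Monoid (++-monoid Bool) using (solve; _⊕_; _⊜_; id)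

-- Determinants with two equal rows

sumSigned-cong : ∀ {n} {g h : Fin n → ℤ} → (∀ j → g j ≡ h j) → sumSigned g ≡ sumSigned h
sumSigned-cong {zero}  e = refl
sumSigned-cong {suc n} e = cong₂ _-_ (e fz) (sumSigned-cong (λ j → e (fs j)))

sumSigned-zero : ∀ {n} {g : Fin n → ℤ} → (∀ j → g j ≡ 0ℤ) → sumSigned g ≡ 0ℤ
sumSigned-zero {zero}  e = refl
sumSigned-zero {suc n} e rewrite e fz | sumSigned-zero (λ j → e (fs j)) = refl

sumSigned-- : ∀ {n} (g h : Fin n → ℤ) →
  sumSigned (λ j → g j - h j) ≡ sumSigned g - sumSigned h
sumSigned-- {zero}  g h = refl
sumSigned-- {suc n} g h rewrite sumSigned-- (λ j → g (fs j)) (λ j → h (fs j)) =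
  regroup (g fz) (h fz) (sumSigned (λ j → g (fs j))) (sumSigned (λ j → h (fs j)))
  where
  regroup : ∀ a b c d → a - b - (c - d) ≡ a - c - (b - d)
  regroup = solveℤ-∀

sumSigned-*ˡ : ∀ {n} (a : ℤ) (g : Fin n → ℤ) → sumSigned (λ j → a *ℤ g j) ≡ a *ℤ sumSigned g
sumSigned-*ˡ {zero}  a g = sym (ℤP.*-zeroʳ a)
sumSigned-*ˡ {suc n} a g rewrite sumSigned-*ˡ a (λ j → g (fs j)) =
  distrib a (g fz) (sumSigned (λ j → g (fs j)))
  where
  distrib : ∀ a b c → a *ℤ b - a *ℤ c ≡ a *ℤ (b - c)
  distrib = solveℤ-∀

det-cong : ∀ {n} {M N : Fin n → Fin n → ℤ} → (∀ r c → M r c ≡ N r c) → det M ≡ det N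
det-cong {zero}  e = refl
det-cong {suc n} e =
  sumSigned-cong (λ j → cong₂ _*ℤ_ (e fz j) (det-cong (λ r c → e (fs r) (punchIn j c))))

-- Signed sum over ordered pairs (c, c′) of distinct indices; swapping c and c′ flips the sign.
pairSum : ∀ {n} → (Fin (suc n) → Fin (suc n) → ℤ) → ℤ
pairSum G = sumSigned (λ c → sumSigned (λ c′ → G c (punchIn c c′)))

pairSum-cong : ∀ {n} {G G′ : Fin (suc n) → Fin (suc n) → ℤ} →
  (∀ c e → G c e ≡ G′ c e) → pairSum G ≡ pairSum G′
pairSum-cong e = sumSigned-cong (λ c → sumSigned-cong (λ c′ → e c (punchIn c c′)))

pairSum-flip : ∀ {n} (G : Fin (suc n) → Fin (suc n) → ℤ) →
  pairSum G ≡ - pairSum (λ c e → G e c)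
pairSum-flip {zero}  G = refl
pairSum-flip {suc n} G = begin
  S₀ - sumSigned (λ c → G (fs c) fz - sumSigned (λ c′ → G (fs c) (fs (punchIn c c′))))
    ≡⟨ cong (λ z → S₀ - z) (sumSigned-- (λ c → G (fs c) fz)
                              (λ c → sumSigned (λ c′ → G (fs c) (fs (punchIn c c′))))) ⟩
  S₀ - (S₁ - pairSum G′)
    ≡⟨ cong (λ z → S₀ - (S₁ - z)) (pairSum-flip G′) ⟩
  S₀ - (S₁ - - pairSum (λ c e → G′ e c))
    ≡⟨ rearrange S₀ S₁ (pairSum (λ c e → G′ e c)) ⟩
  - (S₁ - (S₀ - pairSum (λ c e → G′ e c)))
    ≡⟨ cong (λ z → - (S₁ - z)) (sym (sumSigned-- (λ c → G fz (fs c))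
                                   (λ c → sumSigned (λ c′ → G (fs (punchIn c c′)) (fs c))))) ⟩
  - (S₁ - sumSigned (λ c → G fz (fs c) - sumSigned (λ c′ → G (fs (punchIn c c′)) (fs c)))) ∎
  where
  open ≡-Reasoning
  S₀ = sumSigned (λ c → G fz (fs c))
  S₁ = sumSigned (λ c → G (fs c) fz)
  G′ = λ c e → G (fs c) (fs e)
  rearrange : ∀ a b x → a - (b - - x) ≡ - (b - (a - x))
  rearrange = solveℤ-∀

-- The embedding Fin n → Fin (2 + n) missing both c and e (assumed distinct).
punchIn₂ : ∀ {n} → Fin (suc (suc n)) → Fin (suc (suc n)) → Fin n → Fin (suc (suc n))
punchIn₂ fz     fz     x      = fs (fs x)
punchIn₂ fz     (fs e) x      = fs (punchIn e x)
punchIn₂ (fs c) fz     x      = fs (punchIn c x)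
punchIn₂ {suc n} (fs c) (fs e) fz     = fz
punchIn₂ {suc n} (fs c) (fs e) (fs x) = fs (punchIn₂ c e x)

punchIn₂-comm : ∀ {n} (c e : Fin (suc (suc n))) (x : Fin n) → punchIn₂ c e x ≡ punchIn₂ e c x
punchIn₂-comm fz     fz     x      = refl
punchIn₂-comm fz     (fs e) x      = refl
punchIn₂-comm (fs c) fz     x      = refl
punchIn₂-comm {suc n} (fs c) (fs e) fz     = refl
punchIn₂-comm {suc n} (fs c) (fs e) (fs x) = cong fs (punchIn₂-comm c e x)

punchIn-punchIn : ∀ {n} (c : Fin (suc (suc n))) (c′ : Fin (suc n)) (x : Fin n) →
  punchIn c (punchIn c′ x) ≡ punchIn₂ c (punchIn c c′) x
punchIn-punchIn fz     c′      x      = refl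
punchIn-punchIn (fs c) fz      x      = refl
punchIn-punchIn {suc n} (fs c) (fs c′) fz     = refl
punchIn-punchIn {suc n} (fs c) (fs c′) (fs x) = cong fs (punchIn-punchIn c c′ x)

module _ {n : ℕ} (M : Fin (suc (suc n)) → Fin (suc (suc n)) → ℤ) where

  minor₂ : Fin (suc (suc n)) → Fin (suc (suc n)) → ℤ
  minor₂ c e = det (λ r x → M (fs (fs r)) (punchIn₂ c e x))

  minor₂-comm : ∀ c e → minor₂ c e ≡ minor₂ e c
  minor₂-comm c e = det-cong (λ r x → cong (M (fs (fs r))) (punchIn₂-comm c e x))

  laplace₂ : Fin (suc (suc n)) → Fin (suc (suc n)) → ℤ
  laplace₂ c e = M fz c *ℤ (M (fs fz) e *ℤ minor₂ c e)

  det≡pairSum : det M ≡ pairSum laplace₂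
  det≡pairSum = sumSigned-cong λ c → begin
    M fz c *ℤ sumSigned (λ c′ → M (fs fz) (punchIn c c′) *ℤ
                           det (λ r x → M (fs (fs r)) (punchIn c (punchIn c′ x))))
      ≡⟨ sym (sumSigned-*ˡ (M fz c) (λ c′ → M (fs fz) (punchIn c c′) *ℤ
                           det (λ r x → M (fs (fs r)) (punchIn c (punchIn c′ x))))) ⟩
    sumSigned (λ c′ → M fz c *ℤ (M (fs fz) (punchIn c c′) *ℤ
                           det (λ r x → M (fs (fs r)) (punchIn c (punchIn c′ x)))))
      ≡⟨ sumSigned-cong (λ c′ → cong (λ z → M fz c *ℤ (M (fs fz) (punchIn c c′) *ℤ z))
           (det-cong (λ r x → cong (M (fs (fs r))) (punchIn-punchIn c c′ x)))) ⟩
    sumSigned (λ c′ → laplace₂ c (punchIn c c′)) ∎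
    where open ≡-Reasoning

swap01 : ∀ {n} → Fin (suc (suc n)) → Fin (suc (suc n))
swap01 fz          = fs fz
swap01 (fs fz)     = fz
swap01 (fs (fs r)) = fs (fs r)

*-left-comm : ∀ a b d → a *ℤ (b *ℤ d) ≡ b *ℤ (a *ℤ d)
*-left-comm = solveℤ-∀

det-swap01 : ∀ {n} (M : Fin (suc (suc n)) → Fin (suc (suc n)) → ℤ) →
  det (λ r c → M (swap01 r) c) ≡ - det M
det-swap01 M = begin
  det (λ r c → M (swap01 r) c)     ≡⟨ det≡pairSum (λ r c → M (swap01 r) c) ⟩
  pairSum (laplace₂ (λ r c → M (swap01 r) c))
    ≡⟨ pairSum-cong (λ c e → trans (cong (M (fs fz) c *ℤ_) (cong (M fz e *ℤ_) (minor₂-comm M c e)))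
                                   (*-left-comm (M (fs fz) c) (M fz e) (minor₂ M e c))) ⟩
  pairSum (λ c e → laplace₂ M e c) ≡⟨ pairSum-flip (λ c e → laplace₂ M e c) ⟩
  - pairSum (laplace₂ M)           ≡⟨ cong -_ (sym (det≡pairSum M)) ⟩
  - det M ∎
  where open ≡-Reasoning

x≡-x⇒x≡0 : ∀ (x : ℤ) → x ≡ - x → x ≡ 0ℤ
x≡-x⇒x≡0 +0        _  = refl
x≡-x⇒x≡0 +[1+ n ]  ()
x≡-x⇒x≡0 -[1+ n ]  ()

mutual
  det-equalRows : ∀ {n} (M : Fin n → Fin n → ℤ) (i j : Fin n) → toN i < toN j →
    (∀ c → M i c ≡ M j c) → det M ≡ 0ℤ
  det-equalRows M (fs i) (fs j) i<j eq = det-equalRows-suc M i j i<j eq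
  det-equalRows {suc (suc n)} M fz (fs fz) _ eq = x≡-x⇒x≡0 _ (begin
    det M                            ≡⟨ det≡pairSum M ⟩
    pairSum (laplace₂ M)             ≡⟨ pairSum-cong laplace₂-sym ⟩
    pairSum (λ c e → laplace₂ M e c) ≡⟨ pairSum-flip (λ c e → laplace₂ M e c) ⟩
    - pairSum (laplace₂ M)           ≡⟨ cong -_ (sym (det≡pairSum M)) ⟩
    - det M ∎)
    where
    open ≡-Reasoning
    laplace₂-sym : ∀ c e → laplace₂ M c e ≡ laplace₂ M e c
    laplace₂-sym c e rewrite eq c | eq e | minor₂-comm M c e =
      *-left-comm (M (fs fz) c) (M (fs fz) e) (minor₂ M e c)
  det-equalRows {suc (suc n)} M fz (fs (fs j)) _ eq = begin
    det M                              ≡⟨ sym (ℤP.neg-involutive (det M)) ⟩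
    - - det M                          ≡⟨ cong -_ (sym (det-swap01 M)) ⟩
    - det (λ r c → M (swap01 r) c)
      ≡⟨ cong -_ (det-equalRows-suc (λ r c → M (swap01 r) c) fz (fs j) (s≤s (s≤s z≤n)) eq) ⟩
    - 0ℤ ∎
    where open ≡-Reasoning

  det-equalRows-suc : ∀ {n} (M : Fin (suc n) → Fin (suc n) → ℤ) (i j : Fin n) →
    suc (toN i) < suc (toN j) → (∀ c → M (fs i) c ≡ M (fs j) c) → det M ≡ 0ℤ
  det-equalRows-suc M i j (s≤s i<j) eq = sumSigned-zero λ c →
    trans (cong (M fz c *ℤ_) (det-equalRows (λ r x → M (fs r) (punchIn c x)) i j i<j
                                (λ x → eq (punchIn c x))))
          (ℤP.*-zeroʳ (M fz c))

-- Hankel determinants of s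

toN< : ∀ {n} (i : Fin n) → toN i < n
toN< fz     = s≤s z≤n
toN< (fs i) = s≤s (toN< i)

toN-surjective : ∀ {n} j → j < n → ∃ λ (i : Fin n) → toN i ≡ j
toN-surjective {suc n} zero    _         = fz , refl
toN-surjective {suc n} (suc j) (s≤s j<n) with toN-surjective j j<n
... | i , refl = fs i , refl

H-equalRows : ∀ m n r p → 1 ≤ p → r + p < n →
  (∀ c → c < n → s (m + r + c) ≡ s (m + (r + p) + c)) → H m n ≡ 0ℤ
H-equalRows m n r p 1≤p r+p<n rows
  with toN-surjective r (≤-trans (s≤s (m≤m+n r p)) r+p<n) | toN-surjective (r + p) r+p<n
... | i , refl | j , toNj≡r+p =
  det-equalRows _ i j
    (subst (toN i <_) (sym toNj≡r+p) (subst (_≤ toN i + p) (+-comm (toN i) 1) (+-monoʳ-≤ (toN i) 1≤p)))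
    (λ c → trans (rows (toN c) (toN< c)) (cong (λ z → s (m + z + toN c)) (sym toNj≡r+p)))

letter : ℕ → Bool
letter j = nth (iter (suc j) (true ∷ [])) j

-- s j ≡ bit (letter j) holds by definition.
bit : Bool → ℤ
bit b = if b then 1ℤ else 0ℤ

PeriodicOn : ℕ → ℕ → ℕ → Set
PeriodicOn p L E = ∀ j → L ≤ j → j + p < E → letter j ≡ letter (j + p)

-- The equal rows are 0 and p if L ≤ m, and L − m and L − m + p otherwise.
H-periodicOn : ∀ {p L E} m n → 1 ≤ p → p + 1 ≤ n → m + n + p ≤ E →
  (m < L → L + p < n + m × L + n + p ≤ E) → PeriodicOn p L E → H m n ≡ 0ℤ
H-periodicOn {p} {L} {E} m n 1≤p p+1≤n m+n+p≤E late per with L ≤? m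
... | yes L≤m = H-equalRows m n 0 p 1≤p (subst (_≤ n) (+-comm p 1) p+1≤n) λ c c<n →
  subst₂ (λ u v → s u ≡ s v) (cong (_+ c) (sym (+-identityʳ m))) (xy∙z≈xz∙y m c p)
    (cong bit (per (m + c) (≤-trans L≤m (m≤m+n m c))
      (≤-trans (+-monoˡ-≤ p (+-monoʳ-< m c<n)) m+n+p≤E)))
... | no L≰m with late (≰⇒> L≰m) | m≤n⇒∃[o]m+o≡n (<⇒≤ (≰⇒> L≰m))
... | L+p<n+m , L+n+p≤E | t , refl = H-equalRows m n t p 1≤p (+-cancelˡ-< m (t + p) n t+p<n) λ c c<n →
  subst (λ v → s (m + t + c) ≡ s v) (trans (xy∙z≈xz∙y (m + t) c p) (cong (_+ c) (+-assoc m t p)))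
    (cong bit (per (m + t + c) (m≤m+n (m + t) c)
      (≤-trans (+-monoˡ-≤ p (+-monoʳ-< (m + t) c<n)) L+n+p≤E)))
  where
  t+p<n : m + (t + p) < m + n
  t+p<n = subst (_< m + n) (+-assoc m t p) (subst (m + t + p <_) (+-comm n m) L+p<n+m)

-- The words A k = τᵏ(1) and B k = τᵏ(0)

A : ℕ → List Bool
A k = iter k (true ∷ [])

B : ℕ → List Bool
B k = iter k (false ∷ [])

τ-++ : ∀ u v → τ (u ++ v) ≡ τ u ++ τ v
τ-++ []      v = refl
τ-++ (x ∷ u) v = trans (cong (τ₁ x ++_) (τ-++ u v)) (sym (++-assoc (τ₁ x) (τ u) (τ v)))

iter-++ : ∀ k u v → iter k (u ++ v) ≡ iter k u ++ iter k v
iter-++ zero    u v = refl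
iter-++ (suc k) u v = trans (cong τ (iter-++ k u v)) (τ-++ (iter k u) (iter k v))

iter-[] : ∀ k → iter k [] ≡ []
iter-[] zero    = refl
iter-[] (suc k) = cong τ (iter-[] k)

iter-suc : ∀ k w → iter (suc k) w ≡ iter k (τ w)
iter-suc zero    w = refl
iter-suc (suc k) w = cong τ (iter-suc k w)

iter-+ : ∀ j k w → iter (j + k) w ≡ iter j (iter k w)
iter-+ zero    k w = refl
iter-+ (suc j) k w = cong τ (iter-+ j k w)

A-suc : ∀ k → A (suc k) ≡ A k ++ B k ++ A k
A-suc k = trans (iter-suc k (true ∷ [])) (trans (iter-++ k (true ∷ []) (false ∷ true ∷ []))
  (cong (A k ++_) (iter-++ k (false ∷ []) (true ∷ []))))

B-suc : ∀ k → B (suc k) ≡ A k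
B-suc k = iter-suc k (false ∷ [])

length-A-suc : ∀ k → length (A (suc k)) ≡ length (A k) + (length (B k) + length (A k))
length-A-suc k = trans (cong length (A-suc k))
  (trans (length-++ (A k)) (cong (length (A k) +_) (length-++ (B k))))

mutual
  length-A≥ : ∀ k → suc k ≤ length (A k)
  length-A≥ zero    = s≤s z≤n
  length-A≥ (suc k) rewrite length-A-suc k =
    subst (_≤ length (A k) + (length (B k) + length (A k))) (+-comm (suc k) 1)
      (+-mono-≤ (length-A≥ k) (≤-trans (length-B≥ k) (m≤m+n _ _)))

  length-B≥ : ∀ k → 1 ≤ length (B k)
  length-B≥ zero    = s≤s z≤n
  length-B≥ (suc k) rewrite B-suc k = ≤-trans (s≤s z≤n) (length-A≥ k)

nth-++ˡ : ∀ (u v : List Bool) {i} → i < length u → nth (u ++ v) i ≡ nth u i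
nth-++ˡ (x ∷ u) v {zero}  _         = refl
nth-++ˡ (x ∷ u) v {suc i} (s≤s i<u) = nth-++ˡ u v i<u

nth-++ʳ : ∀ (u v : List Bool) i → nth (u ++ v) (length u + i) ≡ nth v i
nth-++ʳ []      v i = refl
nth-++ʳ (x ∷ u) v i = nth-++ʳ u v i

A-prefix : ∀ t J → ∃ λ Z → A (t + J) ≡ A J ++ Z
A-prefix zero    J = [] , sym (++-identityʳ (A J))
A-prefix (suc t) J with A-prefix t J
... | Z , eq = Z ++ B (t + J) ++ A (t + J) ,
  trans (A-suc (t + J)) (trans (cong (_++ B (t + J) ++ A (t + J)) eq) (++-assoc (A J) Z _))

nth-A-prefix : ∀ J t j → j < length (A J) → nth (A (t + J)) j ≡ nth (A J) j
nth-A-prefix J t j j<A with A-prefix t J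
... | Z , eq = trans (cong (λ w → nth w j) eq) (nth-++ˡ (A J) Z j<A)

letter-A : ∀ N j → j < length (A N) → letter j ≡ nth (A N) j
letter-A N j j<A = begin
  nth (A (suc j)) j     ≡⟨ sym (nth-A-prefix (suc j) N j (≤-trans (n≤1+n _) (length-A≥ (suc j)))) ⟩
  nth (A (N + suc j)) j ≡⟨ cong (λ t → nth (A t) j) (+-comm N (suc j)) ⟩
  nth (A (suc j + N)) j ≡⟨ nth-A-prefix N (suc j) j j<A ⟩
  nth (A N) j ∎
  where open ≡-Reasoning

-- Each A N is a prefix of s (letter-A), so this says that w occurs in s at position i.
OccursAt : ℕ → List Bool → Set
OccursAt i w = ∃ λ N → ∃ λ X → ∃ λ Y → length X ≡ i × A N ≡ X ++ w ++ Y

letter-occursAt : ∀ {i w} → OccursAt i w → ∀ j → j < length w → letter (i + j) ≡ nth w j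
letter-occursAt {w = w} (N , X , Y , refl , eq) j j<w = begin
  letter (length X + j)           ≡⟨ letter-A N _ j+X<A ⟩
  nth (A N) (length X + j)        ≡⟨ cong (λ u → nth u (length X + j)) eq ⟩
  nth (X ++ w ++ Y) (length X + j) ≡⟨ nth-++ʳ X (w ++ Y) j ⟩
  nth (w ++ Y) j                  ≡⟨ nth-++ˡ w Y j<w ⟩
  nth w j ∎
  where
  open ≡-Reasoning
  j+X<A : length X + j < length (A N)
  j+X<A rewrite eq | length-++ X {w ++ Y} | length-++ w {Y} =
    +-monoʳ-< (length X) (≤-trans j<w (m≤m+n _ _))

occursAt-++ˡ : ∀ {i} u v → OccursAt i (u ++ v) → OccursAt i u
occursAt-++ˡ u v (N , X , Y , lX , eq) = N , X , v ++ Y , lX , trans eq (cong (X ++_) (++-assoc u v Y))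

occursAt-++ʳ : ∀ {i} u v → OccursAt i (u ++ v) → OccursAt (i + length u) v
occursAt-++ʳ u v (N , X , Y , refl , eq) =
  N , X ++ u , Y , length-++ X ,
  trans eq (trans (cong (X ++_) (++-assoc u v Y)) (sym (++-assoc X u (v ++ Y))))

Periodic : ℕ → List Bool → Set
Periodic p w = ∀ i → i + p < length w → nth w i ≡ nth w (i + p)

occursAt-periodicOn : ∀ {i p w} → OccursAt i w → Periodic p w → PeriodicOn p i (i + length w)
occursAt-periodicOn {i} {p} {w} occ per j i≤j j+p<E with m≤n⇒∃[o]m+o≡n i≤j
... | t , refl = begin
  letter (i + t)       ≡⟨ letter-occursAt occ t (≤-trans (s≤s (m≤m+n t p)) t+p<w) ⟩
  nth w t              ≡⟨ per t t+p<w ⟩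
  nth w (t + p)        ≡⟨ sym (letter-occursAt occ (t + p) t+p<w) ⟩
  letter (i + (t + p)) ≡⟨ cong letter (sym (+-assoc i t p)) ⟩
  letter (i + t + p) ∎
  where
  open ≡-Reasoning
  t+p<w : t + p < length w
  t+p<w = +-cancelˡ-< i (t + p) (length w) (subst (_< i + length w) (+-assoc i t p) j+p<E)

occursAt-infix : ∀ {i w} X W Y → w ≡ X ++ W ++ Y → OccursAt i w → OccursAt (i + length X) W
occursAt-infix X W Y refl occ = occursAt-++ˡ W Y (occursAt-++ʳ X (W ++ Y) occ)

power : List Bool → ℕ → List Bool
power U zero    = []
power U (suc n) = U ++ power U n

power-comm : ∀ U n → U ++ power U n ≡ power U n ++ U
power-comm U zero    = ++-identityʳ U
power-comm U (suc n) = trans (cong (U ++_) (power-comm U n)) (sym (++-assoc U (power U n) U))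

periodic-power : ∀ U n → Periodic (length U) (power U n)
periodic-power U (suc n) i i+U<w = begin
  nth (U ++ power U n) i               ≡⟨ cong (λ w → nth w i) (power-comm U n) ⟩
  nth (power U n ++ U) i               ≡⟨ nth-++ˡ (power U n) U i<w ⟩
  nth (power U n) i                    ≡⟨ sym (nth-++ʳ U (power U n) i) ⟩
  nth (U ++ power U n) (length U + i)  ≡⟨ cong (nth (U ++ power U n)) (+-comm (length U) i) ⟩
  nth (U ++ power U n) (i + length U) ∎
  where
  open ≡-Reasoning
  i<w : i < length (power U n)
  i<w = +-cancelˡ-< (length U) i _
    (subst₂ _<_ (+-comm i (length U)) (length-++ U) i+U<w)

periodic-infix : ∀ {p} X W Y → Periodic p (X ++ W ++ Y) → Periodic p W
periodic-infix {p} X W Y per i i+p<W = begin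
  nth W i                            ≡⟨ sym (nth-++ˡ W Y (≤-trans (s≤s (m≤m+n i p)) i+p<W)) ⟩
  nth (W ++ Y) i                     ≡⟨ sym (nth-++ʳ X (W ++ Y) i) ⟩
  nth (X ++ W ++ Y) (length X + i)   ≡⟨ per (length X + i) X+i+p<XWY ⟩
  nth (X ++ W ++ Y) (length X + i + p) ≡⟨ cong (nth (X ++ W ++ Y)) (+-assoc (length X) i p) ⟩
  nth (X ++ W ++ Y) (length X + (i + p)) ≡⟨ nth-++ʳ X (W ++ Y) (i + p) ⟩
  nth (W ++ Y) (i + p)               ≡⟨ nth-++ˡ W Y i+p<W ⟩
  nth W (i + p) ∎
  where
  open ≡-Reasoning
  X+i+p<XWY : length X + i + p < length (X ++ W ++ Y)
  X+i+p<XWY rewrite +-assoc (length X) i p | length-++ X {W ++ Y} | length-++ W {Y} =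
    +-monoʳ-< (length X) (≤-trans i+p<W (m≤m+n _ _))

-- U has border Q on the right and P on the left, so Q Uⁿ P is an infix of Uⁿ⁺².
periodic-bordered-power : ∀ {U M Q P Z} n → U ≡ M ++ Q → U ≡ P ++ Z →
  Periodic (length U) (Q ++ power U n ++ P)
periodic-bordered-power {U} {M} {Q} {P} {Z} n U≡MQ U≡PZ =
  periodic-infix M (Q ++ power U n ++ P) Z (subst (Periodic (length U)) Uⁿ⁺²≡ (periodic-power U (2 + n)))
  where
  open ≡-Reasoning
  Uⁿ⁺²≡ : power U (2 + n) ≡ M ++ (Q ++ power U n ++ P) ++ Z
  Uⁿ⁺²≡ = begin
    U ++ U ++ power U n           ≡⟨ cong (U ++_) (power-comm U n) ⟩
    U ++ power U n ++ U           ≡⟨ cong₂ (λ u v → u ++ power U n ++ v) U≡MQ U≡PZ ⟩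
    (M ++ Q) ++ power U n ++ P ++ Z ≡⟨ ++-assoc M Q _ ⟩
    M ++ Q ++ power U n ++ P ++ Z   ≡⟨ cong (λ w → M ++ Q ++ w) (sym (++-assoc (power U n) P Z)) ⟩
    M ++ Q ++ (power U n ++ P) ++ Z ≡⟨ cong (M ++_) (sym (++-assoc Q (power U n ++ P) Z)) ⟩
    M ++ (Q ++ power U n ++ P) ++ Z ∎

-- The border P k

τ₁-palindrome : ∀ x → reverse (τ₁ x) ≡ τ₁ x
τ₁-palindrome true  = refl
τ₁-palindrome false = refl

τ-reverse : ∀ w → τ (reverse w) ≡ reverse (τ w)
τ-reverse []      = refl
τ-reverse (x ∷ w) = begin
  τ (reverse (x ∷ w))          ≡⟨ cong τ (unfold-reverse x w) ⟩
  τ (reverse w ++ x ∷ [])      ≡⟨ τ-++ (reverse w) (x ∷ []) ⟩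
  τ (reverse w) ++ τ₁ x ++ []
    ≡⟨ cong₂ _++_ (τ-reverse w) (trans (++-identityʳ (τ₁ x)) (sym (τ₁-palindrome x))) ⟩
  reverse (τ w) ++ reverse (τ₁ x) ≡⟨ sym (reverse-++ (τ₁ x) (τ w)) ⟩
  reverse (τ₁ x ++ τ w) ∎
  where open ≡-Reasoning

iter-reverse : ∀ k w → iter k (reverse w) ≡ reverse (iter k w)
iter-reverse zero    w = refl
iter-reverse (suc k) w = trans (cong τ (iter-reverse k w)) (τ-reverse (iter k w))

A-palindrome : ∀ k → reverse (A k) ≡ A k
A-palindrome k = sym (iter-reverse k (true ∷ []))

P : ℕ → List Bool
P zero    = []
P (suc k) = τ (P k) ++ true ∷ []

Q : ℕ → List Bool
Q k = reverse (P k)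

centre : ℕ → Bool
centre zero    = true
centre (suc k) = not (centre k)

τ-around-centre : ∀ u b →
  τ (u ++ b ∷ not b ∷ reverse u) ≡ (τ u ++ true ∷ []) ++ not b ∷ b ∷ reverse (τ u ++ true ∷ [])
τ-around-centre u b = begin
  τ (u ++ b ∷ not b ∷ reverse u)
    ≡⟨ τ-++ u (b ∷ not b ∷ reverse u) ⟩
  τ u ++ τ₁ b ++ τ₁ (not b) ++ τ (reverse u)
    ≡⟨ cong (λ w → τ u ++ τ₁ b ++ τ₁ (not b) ++ w) (τ-reverse u) ⟩
  τ u ++ τ₁ b ++ τ₁ (not b) ++ reverse (τ u)
    ≡⟨ cong (τ u ++_) (centre-letters b) ⟩
  τ u ++ true ∷ not b ∷ b ∷ true ∷ reverse (τ u)
    ≡⟨ sym (++-assoc (τ u) (true ∷ []) _) ⟩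
  (τ u ++ true ∷ []) ++ not b ∷ b ∷ true ∷ reverse (τ u)
    ≡⟨ cong (λ w → (τ u ++ true ∷ []) ++ not b ∷ b ∷ w) (sym (reverse-++ (τ u) (true ∷ []))) ⟩
  (τ u ++ true ∷ []) ++ not b ∷ b ∷ reverse (τ u ++ true ∷ []) ∎
  where
  open ≡-Reasoning
  centre-letters : ∀ b → τ₁ b ++ τ₁ (not b) ++ reverse (τ u) ≡ true ∷ not b ∷ b ∷ true ∷ reverse (τ u)
  centre-letters true  = refl
  centre-letters false = refl

A++B≡P++centre : ∀ k → A k ++ B k ≡ P k ++ centre k ∷ not (centre k) ∷ Q k
B++A≡P++centre : ∀ k → B k ++ A k ≡ P k ++ not (centre k) ∷ centre k ∷ Q k
A++B≡P++centre zero    = refl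
A++B≡P++centre (suc k) = begin
  A (suc k) ++ B (suc k) ≡⟨ sym (τ-++ (A k) (B k)) ⟩
  τ (A k ++ B k)         ≡⟨ cong τ (A++B≡P++centre k) ⟩
  τ (P k ++ centre k ∷ not (centre k) ∷ Q k) ≡⟨ τ-around-centre (P k) (centre k) ⟩
  P (suc k) ++ not (centre k) ∷ centre k ∷ Q (suc k)
    ≡⟨ cong (λ b → P (suc k) ++ not (centre k) ∷ b ∷ Q (suc k)) (sym (not-involutive (centre k))) ⟩
  P (suc k) ++ centre (suc k) ∷ not (centre (suc k)) ∷ Q (suc k) ∎
  where open ≡-Reasoning
B++A≡P++centre zero    = refl
B++A≡P++centre (suc k) = begin
  B (suc k) ++ A (suc k) ≡⟨ sym (τ-++ (B k) (A k)) ⟩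
  τ (B k ++ A k)         ≡⟨ cong τ (B++A≡P++centre k) ⟩
  τ (P k ++ not (centre k) ∷ centre k ∷ Q k)
    ≡⟨ cong (λ b → τ (P k ++ not (centre k) ∷ b ∷ Q k)) (sym (not-involutive (centre k))) ⟩
  τ (P k ++ not (centre k) ∷ not (not (centre k)) ∷ Q k) ≡⟨ τ-around-centre (P k) (not (centre k)) ⟩
  P (suc k) ++ not (centre (suc k)) ∷ centre (suc k) ∷ Q (suc k) ∎
  where open ≡-Reasoning

length-A+B : ∀ k → length (A k) + length (B k) ≡ 2 + (length (P k) + length (P k))
length-A+B k = begin
  length (A k) + length (B k)   ≡⟨ sym (length-++ (A k)) ⟩
  length (A k ++ B k)           ≡⟨ cong length (A++B≡P++centre k) ⟩
  length (P k ++ centre k ∷ not (centre k) ∷ Q k) ≡⟨ length-++ (P k) ⟩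
  length (P k) + (2 + length (Q k)) ≡⟨ cong (λ q → length (P k) + (2 + q)) (length-reverse (P k)) ⟩
  length (P k) + (2 + length (P k)) ≡⟨ +-suc (length (P k)) (suc (length (P k))) ⟩
  suc (length (P k) + suc (length (P k))) ≡⟨ cong suc (+-suc (length (P k)) (length (P k))) ⟩
  2 + (length (P k) + length (P k)) ∎
  where open ≡-Reasoning

length-B≤length-A : ∀ k → length (B k) ≤ length (A k)
length-B≤length-A zero    = s≤s z≤n
length-B≤length-A (suc k) rewrite B-suc k | length-A-suc k = m≤m+n _ _

length-P≤length-A : ∀ k → length (P k) ≤ length (A k)
length-P≤length-A k = +-cancel-≤-double (≤-trans (≤-trans (n≤1+n _) (n≤1+n _))
  (≤-trans (≤-reflexive (sym (length-A+B k))) (+-monoʳ-≤ (length (A k)) (length-B≤length-A k))))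
  where
  +-cancel-≤-double : ∀ {p a} → p + p ≤ a + a → p ≤ a
  +-cancel-≤-double {p} {a} p+p≤a+a with p ≤? a
  ... | yes p≤a = p≤a
  ... | no p≰a  = contradiction p+p≤a+a (<⇒≱ (+-mono-< (≰⇒> p≰a) (≰⇒> p≰a)))

++-prefix : ∀ (xs ys zs ws : List Bool) → xs ++ ys ≡ zs ++ ws → length zs ≤ length xs →
  ∃ λ us → xs ≡ zs ++ us
++-prefix xs       ys []       ws eq _           = xs , refl
++-prefix (x ∷ xs) ys (z ∷ zs) ws eq (s≤s zs≤xs) with ++-prefix xs ys zs ws (∷-injectiveʳ eq) zs≤xs
... | us , refl = us , cong (_∷ zs ++ us) (∷-injectiveˡ eq)

P-prefix : ∀ k → ∃ λ Z → A k ≡ P k ++ Z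
P-prefix k = ++-prefix (A k) (B k) (P k) _ (A++B≡P++centre k) (length-P≤length-A k)

Q-suffix : ∀ k → ∃ λ M → A k ≡ M ++ Q k
Q-suffix k with P-prefix k
... | Z , A≡PZ = reverse Z , (begin
  A k                     ≡⟨ sym (A-palindrome k) ⟩
  reverse (A k)           ≡⟨ cong reverse A≡PZ ⟩
  reverse (P k ++ Z)      ≡⟨ reverse-++ (P k) Z ⟩
  reverse Z ++ Q k ∎)
  where open ≡-Reasoning

length-power : ∀ U n → length (power U n) ≡ n * length U
length-power U zero    = refl
length-power U (suc n) = trans (length-++ U) (cong (length U +_) (length-power U n))

periodic-window : ∀ k n → Periodic (length (A k)) (Q k ++ power (A k) n ++ P k)
periodic-window k n = periodic-bordered-power {Q = Q k} {P = P k} n (proj₂ (Q-suffix k)) (proj₂ (P-prefix k))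

periodic-window-suc : ∀ k → Periodic (2 + (length (P k) + length (P k))) (Q k ++ A (suc k) ++ P k)
periodic-window-suc k =
  subst (λ q → Periodic q (Q k ++ A (suc k) ++ P k)) (trans (length-++ (A k)) (length-A+B k))
    (periodic-infix (P k ++ mid) (Q k ++ A (suc k) ++ P k) (mid′ ++ Q k ++ B k)
      (subst (Periodic (length (A k ++ B k))) AB⁴≡ (periodic-power (A k ++ B k) 4)))
  where
  open ≡-Reasoning
  mid  = centre k ∷ not (centre k) ∷ []
  mid′ = not (centre k) ∷ centre k ∷ []
  AB⁴≡ : power (A k ++ B k) 4 ≡ (P k ++ mid) ++ (Q k ++ A (suc k) ++ P k) ++ (mid′ ++ Q k ++ B k)
  AB⁴≡ = begin
    power (A k ++ B k) 4
      ≡⟨ solve 2 (λ a b → (a ⊕ b) ⊕ ((a ⊕ b) ⊕ ((a ⊕ b) ⊕ ((a ⊕ b) ⊕ id)))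
                        ⊜ (a ⊕ b) ⊕ ((a ⊕ (b ⊕ a)) ⊕ ((b ⊕ a) ⊕ b))) refl (A k) (B k) ⟩
    (A k ++ B k) ++ (A k ++ B k ++ A k) ++ (B k ++ A k) ++ B k
      ≡⟨ cong (λ w → (A k ++ B k) ++ w ++ (B k ++ A k) ++ B k) (sym (A-suc k)) ⟩
    (A k ++ B k) ++ A (suc k) ++ (B k ++ A k) ++ B k
      ≡⟨ cong₂ (λ u v → u ++ A (suc k) ++ v ++ B k) (A++B≡P++centre k) (B++A≡P++centre k) ⟩
    (P k ++ mid ++ Q k) ++ A (suc k) ++ (P k ++ mid′ ++ Q k) ++ B k
      ≡⟨ solve 6 (λ p x q a y b → (p ⊕ (x ⊕ q)) ⊕ (a ⊕ ((p ⊕ (y ⊕ q)) ⊕ b))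
                               ⊜ (p ⊕ x) ⊕ ((q ⊕ (a ⊕ p)) ⊕ (y ⊕ (q ⊕ b)))) refl
           (P k) mid (Q k) (A (suc k)) mid′ (B k) ⟩
    (P k ++ mid) ++ (Q k ++ A (suc k) ++ P k) ++ (mid′ ++ Q k ++ B k) ∎

periodic-A-suc++P : ∀ k → Periodic (2 + (length (P k) + length (P k))) (A (suc k) ++ P k)
periodic-A-suc++P k = periodic-infix (Q k) (A (suc k) ++ P k) []
  (subst (Periodic _) (cong (Q k ++_) (sym (++-identityʳ _))) (periodic-window-suc k))

-- Numeration and prefixes of s

-- For admissible d, prefixWord d is the prefix of s of length val d.
prefixWord : List Bool → List Bool
prefixWord []            = []
prefixWord (a₀ ∷ [])     = if a₀ then true ∷ [] else []
prefixWord (a₀ ∷ a₁ ∷ d) =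
  τ (prefixWord d) ++ (if a₁ then true ∷ false ∷ [] else []) ++ (if a₀ then true ∷ [] else [])

admissible-drop₂ : ∀ a₀ a₁ d → Admissible (a₀ ∷ a₁ ∷ d) → Admissible d
admissible-drop₂ a₀ a₁ d (adj , gap) =
  (λ i → adj (2 + i)) ,
  (λ t dₜ → subst (λ z → nth (a₀ ∷ a₁ ∷ d) z ≡ false) (shift₂ t)
               (gap (suc t) (subst (λ z → nth (a₀ ∷ a₁ ∷ d) z ≡ true) (sym (shift₀ t)) dₜ)))
  where
  shift₀ : ∀ t → 2 * suc t ≡ 2 + 2 * t
  shift₀ = solve-∀
  shift₂ : ∀ t → 2 * suc t + 2 ≡ 2 + (2 * t + 2)
  shift₂ = solve-∀

prefixWord-in-A : ∀ d → Admissible d → ∃ λ J → ∃ λ R → A J ≡ prefixWord d ++ not (nth d 0) ∷ R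
prefixWord-in-A []           _ = 0 , [] , refl
prefixWord-in-A (false ∷ []) _ = 0 , [] , refl
prefixWord-in-A (true ∷ [])  _ = 1 , true ∷ [] , refl
prefixWord-in-A (a₀ ∷ a₁ ∷ d) adm
  with prefixWord-in-A d (admissible-drop₂ a₀ a₁ d adm)
prefixWord-in-A (true ∷ true ∷ d) (adj , _) | _ with adj 0 refl
... | ()
prefixWord-in-A (false ∷ false ∷ d) _ | J , R , eq = suc J , rest (not (nth d 0)) ++ τ R , (begin
  τ (A J)                                          ≡⟨ cong τ eq ⟩
  τ (prefixWord d ++ not (nth d 0) ∷ R)             ≡⟨ τ-++ (prefixWord d) _ ⟩
  τ (prefixWord d) ++ τ₁ (not (nth d 0)) ++ τ R
    ≡⟨ cong (λ w → τ (prefixWord d) ++ w ++ τ R) (τ₁-head (not (nth d 0))) ⟩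
  τ (prefixWord d) ++ true ∷ rest (not (nth d 0)) ++ τ R
    ≡⟨ cong (_++ true ∷ rest (not (nth d 0)) ++ τ R) (sym (++-identityʳ (τ (prefixWord d)))) ⟩
  (τ (prefixWord d) ++ []) ++ true ∷ rest (not (nth d 0)) ++ τ R ∎)
  where
  open ≡-Reasoning
  rest : Bool → List Bool
  rest true  = false ∷ true ∷ []
  rest false = []
  τ₁-head : ∀ x → τ₁ x ≡ true ∷ rest x
  τ₁-head true  = refl
  τ₁-head false = refl
prefixWord-in-A (false ∷ true ∷ d) (adj , _) | J , R , eq = suc J , τ R , (begin
  τ (A J)                                         ≡⟨ cong τ eq ⟩
  τ (prefixWord d ++ not (nth d 0) ∷ R)
    ≡⟨ cong (λ z → τ (prefixWord d ++ not z ∷ R)) (adj 1 refl) ⟩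
  τ (prefixWord d ++ true ∷ R)                     ≡⟨ τ-++ (prefixWord d) _ ⟩
  τ (prefixWord d) ++ (true ∷ false ∷ []) ++ true ∷ τ R
    ≡⟨ sym (++-assoc (τ (prefixWord d)) (true ∷ false ∷ []) _) ⟩
  (τ (prefixWord d) ++ true ∷ false ∷ []) ++ true ∷ τ R
    ≡⟨ cong (λ w → (τ (prefixWord d) ++ w) ++ true ∷ τ R) (sym (++-identityʳ (true ∷ false ∷ []))) ⟩
  (τ (prefixWord d) ++ (true ∷ false ∷ []) ++ []) ++ true ∷ τ R ∎)
  where open ≡-Reasoning
prefixWord-in-A (true ∷ false ∷ d) (_ , gap) | J , R , eq = suc J , true ∷ τ R , (begin
  τ (A J)                                         ≡⟨ cong τ eq ⟩
  τ (prefixWord d ++ not (nth d 0) ∷ R)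
    ≡⟨ cong (λ z → τ (prefixWord d ++ not z ∷ R)) (gap 0 refl) ⟩
  τ (prefixWord d ++ true ∷ R)                     ≡⟨ τ-++ (prefixWord d) _ ⟩
  τ (prefixWord d) ++ (true ∷ []) ++ false ∷ true ∷ τ R
    ≡⟨ sym (++-assoc (τ (prefixWord d)) (true ∷ []) _) ⟩
  (τ (prefixWord d) ++ [] ++ true ∷ []) ++ false ∷ true ∷ τ R ∎)
  where open ≡-Reasoning

f-shift : ∀ k j i → fAux j (k + k + i) ≡ fAux (j + k) i
f-shift zero    j i = cong (λ z → fAux z i) (sym (+-identityʳ j))
f-shift (suc k) j i = begin
  fAux j (suc k + suc k + i)   ≡⟨ cong (fAux j) (two-more k i) ⟩
  fAux (suc j) (k + k + i)     ≡⟨ f-shift k (suc j) i ⟩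
  fAux (suc j + k) i           ≡⟨ cong (λ z → fAux z i) (sym (+-suc j k)) ⟩
  fAux (j + suc k) i ∎
  where
  open ≡-Reasoning
  two-more : ∀ k i → suc k + suc k + i ≡ 2 + (k + k + i)
  two-more = solve-∀

f-even : ∀ k → f (2 * k) ≡ length (A k)
f-even k = trans (cong f (double k)) (f-shift k 0 0)
  where
  double : ∀ k → 2 * k ≡ k + k + 0
  double = solve-∀

f-odd : ∀ k → f (2 * k + 1) ≡ length (A k) + length (B k)
f-odd k = begin
  f (2 * k + 1)                          ≡⟨ cong f (double k) ⟩
  f (k + k + 1)                          ≡⟨ f-shift k 0 1 ⟩
  length (iter k (true ∷ false ∷ []))    ≡⟨ cong length (iter-++ k (true ∷ []) (false ∷ [])) ⟩
  length (A k ++ B k)                    ≡⟨ length-++ (A k) ⟩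
  length (A k) + length (B k) ∎
  where
  open ≡-Reasoning
  double : ∀ k → 2 * k + 1 ≡ k + k + 1
  double = solve-∀

length-iter-digit₀ : ∀ j a → length (iter j (if a then true ∷ [] else [])) ≡ (if a then f (2 * j) else 0)
length-iter-digit₀ j true  = sym (f-even j)
length-iter-digit₀ j false = cong length (iter-[] j)

length-iter-digit₁ : ∀ j a →
  length (iter j (if a then true ∷ false ∷ [] else [])) ≡ (if a then f (suc (2 * j)) else 0)
length-iter-digit₁ j true  = begin
  length (iter j (true ∷ false ∷ [])) ≡⟨ cong length (iter-++ j (true ∷ []) (false ∷ [])) ⟩
  length (A j ++ B j)                 ≡⟨ length-++ (A j) ⟩
  length (A j) + length (B j)         ≡⟨ sym (f-odd j) ⟩
  f (2 * j + 1)                       ≡⟨ cong f (+-comm (2 * j) 1) ⟩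
  f (suc (2 * j)) ∎
  where open ≡-Reasoning
length-iter-digit₁ j false = cong length (iter-[] j)

length-iter-prefixWord : ∀ j d → length (iter j (prefixWord d)) ≡ valFrom (2 * j) d
length-iter-prefixWord j []            = cong length (iter-[] j)
length-iter-prefixWord j (a₀ ∷ [])     = trans (length-iter-digit₀ j a₀) (sym (+-identityʳ _))
length-iter-prefixWord j (a₀ ∷ a₁ ∷ d) = begin
  length (iter j (t ++ u₁ ++ u₀))
    ≡⟨ cong length (trans (iter-++ j t _) (cong (iter j t ++_) (iter-++ j u₁ u₀))) ⟩
  length (iter j t ++ iter j u₁ ++ iter j u₀)
    ≡⟨ trans (length-++ (iter j t)) (cong (length (iter j t) +_) (length-++ (iter j u₁))) ⟩
  length (iter j t) + (length (iter j u₁) + length (iter j u₀))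
    ≡⟨ cong₂ _+_ high (cong₂ _+_ (length-iter-digit₁ j a₁) (length-iter-digit₀ j a₀)) ⟩
  valFrom (2 + 2 * j) d + (v₁ + v₀)
    ≡⟨ reverse-sum (valFrom (2 + 2 * j) d) v₁ v₀ ⟩
  v₀ + (v₁ + valFrom (2 + 2 * j) d) ∎
  where
  open ≡-Reasoning
  t  = τ (prefixWord d)
  u₀ = if a₀ then true ∷ [] else []
  u₁ = if a₁ then true ∷ false ∷ [] else []
  v₀ = if a₀ then f (2 * j) else 0
  v₁ = if a₁ then f (suc (2 * j)) else 0
  high : length (iter j t) ≡ valFrom (2 + 2 * j) d
  high = begin
    length (iter j t)                      ≡⟨ cong length (sym (iter-suc j (prefixWord d))) ⟩
    length (iter (suc j) (prefixWord d))   ≡⟨ length-iter-prefixWord (suc j) d ⟩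
    valFrom (2 * suc j) d                  ≡⟨ cong (λ i → valFrom i d) (*-suc 2 j) ⟩
    valFrom (2 + 2 * j) d ∎
  reverse-sum : ∀ x y z → x + (y + z) ≡ z + (y + x)
  reverse-sum = solve-∀

valFrom-split : ∀ n i d → valFrom i d ≡ valFrom i (take n d) + valFrom (n + i) (drop n d)
valFrom-split zero    i d       = refl
valFrom-split (suc n) i []      = refl
valFrom-split (suc n) i (b ∷ d) = begin
  v + valFrom (suc i) d
    ≡⟨ cong (v +_) (valFrom-split n (suc i) d) ⟩
  v + (valFrom (suc i) (take n d) + valFrom (n + suc i) (drop n d))
    ≡⟨ cong (λ j → v + (valFrom (suc i) (take n d) + valFrom j (drop n d))) (+-suc n i) ⟩
  v + (valFrom (suc i) (take n d) + valFrom (suc n + i) (drop n d))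
    ≡⟨ sym (+-assoc v _ _) ⟩
  v + valFrom (suc i) (take n d) + valFrom (suc n + i) (drop n d) ∎
  where
  open ≡-Reasoning
  v = if b then f i else 0

digit-≤-valFrom : ∀ n i d → nth d n ≡ true → f (n + i) ≤ valFrom i (take (suc n) d)
digit-≤-valFrom zero    i (true ∷ d) _  = m≤m+n _ _
digit-≤-valFrom (suc n) i (b ∷ d)    dₙ =
  subst (_≤ (if b then f i else 0) + valFrom (suc i) (take (suc n) d)) (cong f (+-suc n i))
    (≤-trans (digit-≤-valFrom n (suc i) d dₙ) (m≤n+m _ _))

digit-zero : ∀ n d → val (take (suc n) d) < f n → nth d n ≡ false
digit-zero n d small with nth d n in dₙ
... | false = refl
... | true  = contradiction (subst (_≤ val (take (suc n) d)) (cong f (+-identityʳ n)) (digit-≤-valFrom n 0 d dₙ))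
                            (<⇒≱ small)

valFrom-drop-zero : ∀ n i d → nth d n ≡ false →
  valFrom (n + i) (drop n d) ≡ valFrom (suc n + i) (drop (suc n) d)
valFrom-drop-zero zero    i []          _  = refl
valFrom-drop-zero zero    i (false ∷ d) _  = refl
valFrom-drop-zero (suc n) i []          _  = refl
valFrom-drop-zero (suc n) i (b ∷ d)     dₙ = begin
  valFrom (suc n + i) (drop n d)       ≡⟨ cong (λ j → valFrom j (drop n d)) (sym (+-suc n i)) ⟩
  valFrom (n + suc i) (drop n d)       ≡⟨ valFrom-drop-zero n (suc i) d dₙ ⟩
  valFrom (suc n + suc i) (drop (suc n) d) ≡⟨ cong (λ j → valFrom j (drop (suc n) d)) (+-suc (suc n) i) ⟩
  valFrom (suc (suc n) + i) (drop (suc n) d) ∎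
  where open ≡-Reasoning

nth-drop : ∀ n (d : List Bool) i → nth (drop n d) i ≡ nth d (n + i)
nth-drop zero    d       i = refl
nth-drop (suc n) []      i = refl
nth-drop (suc n) (b ∷ d) i = nth-drop n d i

admissible-drop-even : ∀ K d → Admissible d → Admissible (drop (2 * K) d)
admissible-drop-even K d (adj , gap) =
  (λ i dᵢ → trans (nth-drop (2 * K) d (suc i)) (trans (cong (nth d) (+-suc (2 * K) i))
               (adj (2 * K + i) (trans (sym (nth-drop (2 * K) d i)) dᵢ)))) ,
  (λ t dₜ → trans (nth-drop (2 * K) d (2 * t + 2)) (trans (cong (nth d) (shift₂ K t))
               (gap (K + t) (trans (cong (nth d) (sym (shift₀ K t))) (trans (sym (nth-drop (2 * K) d (2 * t))) dₜ)))))
  where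
  shift₀ : ∀ K t → 2 * K + 2 * t ≡ 2 * (K + t)
  shift₀ = solve-∀
  shift₂ : ∀ K t → 2 * K + (2 * t + 2) ≡ 2 * (K + t) + 2
  shift₂ = solve-∀

iter-suc-begins-with-A : ∀ k y W → ∃ λ Z → iter (suc k) (y ∷ W) ≡ A k ++ Z
iter-suc-begins-with-A k true  W = (B k ++ A k) ++ iter (suc k) W ,
  trans (iter-++ (suc k) (true ∷ []) W) (trans (cong (_++ iter (suc k) W) (A-suc k)) (++-assoc (A k) (B k ++ A k) _))
iter-suc-begins-with-A k false W = iter (suc k) W ,
  trans (iter-++ (suc k) (false ∷ []) W) (cong (_++ iter (suc k) W) (B-suc k))

iter-suc-begins-with-AP : ∀ k w → 2 ≤ length w → ∃ λ Z → iter (suc k) w ≡ A k ++ P k ++ Z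
iter-suc-begins-with-AP k (_ ∷ []) (s≤s ())
iter-suc-begins-with-AP k (true ∷ y′ ∷ W) _ =
  (not (centre k) ∷ centre k ∷ Q k) ++ iter (suc k) (y′ ∷ W) , (begin
  iter (suc k) (true ∷ y′ ∷ W)                 ≡⟨ iter-++ (suc k) (true ∷ []) (y′ ∷ W) ⟩
  A (suc k) ++ iter (suc k) (y′ ∷ W)           ≡⟨ cong (_++ iter (suc k) (y′ ∷ W)) (A-suc k) ⟩
  (A k ++ B k ++ A k) ++ iter (suc k) (y′ ∷ W) ≡⟨ ++-assoc (A k) (B k ++ A k) _ ⟩
  A k ++ (B k ++ A k) ++ iter (suc k) (y′ ∷ W)
    ≡⟨ cong (λ w → A k ++ w ++ iter (suc k) (y′ ∷ W)) (B++A≡P++centre k) ⟩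
  A k ++ (P k ++ not (centre k) ∷ centre k ∷ Q k) ++ iter (suc k) (y′ ∷ W)
    ≡⟨ cong (A k ++_) (++-assoc (P k) _ _) ⟩
  A k ++ P k ++ (not (centre k) ∷ centre k ∷ Q k) ++ iter (suc k) (y′ ∷ W) ∎)
  where open ≡-Reasoning
iter-suc-begins-with-AP k (false ∷ y′ ∷ W) _ with iter-suc-begins-with-A k y′ W | P-prefix k
... | Z , eqZ | Z′ , A≡PZ′ = Z′ ++ Z , (begin
  iter (suc k) (false ∷ y′ ∷ W)         ≡⟨ iter-++ (suc k) (false ∷ []) (y′ ∷ W) ⟩
  B (suc k) ++ iter (suc k) (y′ ∷ W)    ≡⟨ cong₂ _++_ (B-suc k) eqZ ⟩
  A k ++ A k ++ Z                       ≡⟨ cong (λ w → A k ++ w ++ Z) A≡PZ′ ⟩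
  A k ++ (P k ++ Z′) ++ Z               ≡⟨ cong (A k ++_) (++-assoc (P k) Z′ Z) ⟩
  A k ++ P k ++ Z′ ++ Z ∎)
  where open ≡-Reasoning

iter-suc-ends-with-A : ∀ k x W → ∃ λ T → iter (suc k) (x ∷ W) ≡ T ++ A k
iter-suc-ends-with-A k true  [] = A k ++ B k , trans (A-suc k) (sym (++-assoc (A k) (B k) (A k)))
iter-suc-ends-with-A k false [] = [] , B-suc k
iter-suc-ends-with-A k x (y ∷ W) with iter-suc-ends-with-A k y W
... | T , eq = iter (suc k) (x ∷ []) ++ T ,
  trans (iter-++ (suc k) (x ∷ []) (y ∷ W))
    (trans (cong (iter (suc k) (x ∷ []) ++_) eq) (sym (++-assoc (iter (suc k) (x ∷ [])) T (A k))))

-- Φ_k(x) < f_{2k+2} forces the digit of index 2k+2 to vanish, so x − Φ_k(x) is the value of the higher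
-- digits, and the prefix of s of that length is τᵏ⁺¹ applied to the prefix for the shifted digits.
anchor : ∀ k {x v} → PhiIs k x v → v < length (A (suc k)) →
  ∃ λ u → (x ≡ v + length (iter (suc k) u)) × OccursAt 0 (iter (suc k) u ++ A (suc k) ++ A k ++ P k)
anchor k (d , (adm , refl) , refl) Φ<A = u , value , occurrence
  where
  open ≡-Reasoning
  n = 2 * suc k
  e = drop n d
  u = prefixWord e
  Φ = val (take (2 * k + 3) d)

  take≡ : take (2 * k + 3) d ≡ take (suc n) d
  take≡ = cong (λ t → take t d) (index k)
    where
    index : ∀ k → 2 * k + 3 ≡ suc (2 * suc k)
    index = solve-∀

  dₙ≡false : nth d n ≡ false
  dₙ≡false = digit-zero n d (subst₂ _<_ (cong val take≡) (sym (f-even (suc k))) Φ<A)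

  value : val d ≡ Φ + length (iter (suc k) u)
  value = begin
    val d                                                      ≡⟨ valFrom-split (suc n) 0 d ⟩
    val (take (suc n) d) + valFrom (suc n + 0) (drop (suc n) d)
      ≡⟨ cong₂ _+_ (cong val (sym take≡)) (sym (valFrom-drop-zero n 0 d dₙ≡false)) ⟩
    Φ + valFrom (n + 0) e                                      ≡⟨ cong (λ i → Φ + valFrom i e) (+-identityʳ n) ⟩
    Φ + valFrom n e
      ≡⟨ cong (Φ +_) (sym (length-iter-prefixWord (suc k) e)) ⟩
    Φ + length (iter (suc k) u) ∎

  e₀≡false : nth e 0 ≡ false
  e₀≡false = trans (nth-drop n d 0) (trans (cong (nth d) (+-identityʳ n)) dₙ≡false)

  occurrence : OccursAt 0 (iter (suc k) u ++ A (suc k) ++ A k ++ P k)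
  occurrence with prefixWord-in-A e (admissible-drop-even (suc k) d adm)
  ... | J , R , A≡ with iter-suc-begins-with-AP k (R ++ B J ++ A J) long
    where
    long : 2 ≤ length (R ++ B J ++ A J)
    long = subst (2 ≤_) (sym (trans (length-++ R) (cong (length R +_) (length-++ (B J)))))
      (≤-trans (+-mono-≤ (length-B≥ J) (≤-trans (s≤s z≤n) (length-A≥ J))) (m≤n+m _ (length R)))
  ... | Z , iter≡ = suc k + suc J , [] , Z , refl , (begin
    A (suc k + suc J)                                 ≡⟨ iter-+ (suc k) (suc J) (true ∷ []) ⟩
    iter (suc k) (A (suc J))                          ≡⟨ cong (iter (suc k)) (A-suc J) ⟩
    iter (suc k) (A J ++ B J ++ A J)                  ≡⟨ cong (λ w → iter (suc k) (w ++ B J ++ A J)) A≡ ⟩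
    iter (suc k) ((u ++ not (nth e 0) ∷ R) ++ B J ++ A J)
      ≡⟨ cong (λ b → iter (suc k) ((u ++ not b ∷ R) ++ B J ++ A J)) e₀≡false ⟩
    iter (suc k) ((u ++ true ∷ R) ++ B J ++ A J)      ≡⟨ cong (iter (suc k)) (++-assoc u (true ∷ R) _) ⟩
    iter (suc k) (u ++ (true ∷ []) ++ R ++ B J ++ A J)
      ≡⟨ trans (iter-++ (suc k) u _) (cong (iter (suc k) u ++_) (iter-++ (suc k) (true ∷ []) _)) ⟩
    iter (suc k) u ++ A (suc k) ++ iter (suc k) (R ++ B J ++ A J)
      ≡⟨ cong (λ w → iter (suc k) u ++ A (suc k) ++ w) iter≡ ⟩
    iter (suc k) u ++ A (suc k) ++ A k ++ P k ++ Z
      ≡⟨ solve 5 (λ x y z w t → x ⊕ (y ⊕ (z ⊕ (w ⊕ t))) ⊜ (x ⊕ (y ⊕ (z ⊕ w))) ⊕ t) refl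
           (iter (suc k) u) (A (suc k)) (A k) (P k) Z ⟩
    (iter (suc k) u ++ A (suc k) ++ A k ++ P k) ++ Z ∎)

-- The three vanishing regions

≤-rebalance : ∀ {x y x′ y′} → x ≤ y → y′ + x ≡ y + x′ → x′ ≤ y′
≤-rebalance {x} {y} {x′} {y′} x≤y eq =
  +-cancelʳ-≤ x x′ y′ (≤-trans (+-monoʳ-≤ x′ x≤y) (≤-reflexive (trans (+-comm x′ y) (sym eq))))

half-of-double : ∀ {v} x → v ≡ x + x → ⌊ v /2⌋ ≡ x
half-of-double x refl = sym (n≡⌊n+n/2⌋ x)

module _ (k : ℕ) where

  private
    a  = length (A k)
    p  = length (P k)
    ab = 2 + (p + p)

  length-A-suc≡a+ab : length (A (suc k)) ≡ a + ab
  length-A-suc≡a+ab = begin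
    length (A (suc k))         ≡⟨ length-A-suc k ⟩
    a + (length (B k) + a)     ≡⟨ cong (a +_) (+-comm (length (B k)) a) ⟩
    a + (a + length (B k))     ≡⟨ cong (a +_) (length-A+B k) ⟩
    a + ab ∎
    where open ≡-Reasoning

  f-2k+1 : f (2 * k + 1) ≡ ab
  f-2k+1 = trans (f-odd k) (length-A+B k)

  f-2k+2 : f (2 * k + 2) ≡ a + ab
  f-2k+2 = trans (cong f (trans (+-comm (2 * k) 2) (sym (*-suc 2 k)))) (trans (f-even (suc k)) length-A-suc≡a+ab)

  f-2k+3 : f (2 * k + 3) ≡ a + ab + a
  f-2k+3 = begin
    f (2 * k + 3)                             ≡⟨ cong f (index k) ⟩
    f (2 * suc k + 1)                         ≡⟨ f-odd (suc k) ⟩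
    length (A (suc k)) + length (B (suc k))   ≡⟨ cong₂ _+_ length-A-suc≡a+ab (cong length (B-suc k)) ⟩
    a + ab + a ∎
    where
    open ≡-Reasoning
    index : ∀ k → 2 * k + 3 ≡ 2 * suc k + 1
    index = solve-∀

  length-A-suc-suc : length (A (suc (suc k))) ≡ a + ab + (a + (a + ab))
  length-A-suc-suc =
    trans (length-A-suc (suc k)) (cong₂ (λ u v → u + (v + u)) length-A-suc≡a+ab (cong length (B-suc k)))

  f-2k+5 : f (2 * suc k + 3) ≡ a + ab + (a + (a + ab)) + (a + ab)
  f-2k+5 = begin
    f (2 * suc k + 3)                                   ≡⟨ cong f (index k) ⟩
    f (2 * suc (suc k) + 1)                             ≡⟨ f-odd (suc (suc k)) ⟩
    length (A (suc (suc k))) + length (B (suc (suc k)))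
      ≡⟨ cong₂ _+_ length-A-suc-suc (trans (cong length (B-suc (suc k))) length-A-suc≡a+ab) ⟩
    a + ab + (a + (a + ab)) + (a + ab) ∎
    where
    open ≡-Reasoning
    index : ∀ k → 2 * suc k + 3 ≡ 2 * suc (suc k) + 1
    index = solve-∀

  half-f-2k+1 : ⌊ f (2 * k + 1) /2⌋ ≡ suc p
  half-f-2k+1 = half-of-double (suc p) (trans f-2k+1 (double p))
    where
    double : ∀ p → 2 + (p + p) ≡ suc p + suc p
    double = solve-∀

  half-f-2k+3 : ⌊ f (2 * k + 3) /2⌋ ≡ a + suc p
  half-f-2k+3 = half-of-double (a + suc p) (trans f-2k+3 (double a p))
    where
    double : ∀ a p → a + (2 + (p + p)) + a ≡ a + suc p + (a + suc p)
    double = solve-∀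

  half-f-2k+5 : ⌊ f (2 * suc k + 3) /2⌋ ≡ a + ab + (a + suc p)
  half-f-2k+5 = half-of-double (a + ab + (a + suc p)) (trans f-2k+5 (double a p))
    where
    double : ∀ a p → a + (2 + (p + p)) + (a + (a + (2 + (p + p)))) + (a + (2 + (p + p)))
                   ≡ a + (2 + (p + p)) + (a + suc p) + (a + (2 + (p + p)) + (a + suc p))
    double = solve-∀

  length-window : ∀ n → length (Q k ++ power (A k) n ++ P k) ≡ p + (n * a + p)
  length-window n = begin
    length (Q k ++ power (A k) n ++ P k)                 ≡⟨ length-++ (Q k) ⟩
    length (Q k) + length (power (A k) n ++ P k)
      ≡⟨ cong₂ _+_ (length-reverse (P k)) (length-++ (power (A k) n)) ⟩
    p + (length (power (A k) n) + p)                     ≡⟨ cong (λ q → p + (q + p)) (length-power (A k) n) ⟩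
    p + (n * a + p) ∎
    where open ≡-Reasoning

  length-A-suc++P : length (A (suc k) ++ P k) ≡ a + ab + p
  length-A-suc++P = trans (length-++ (A (suc k))) (cong (_+ p) length-A-suc≡a+ab)

  length-window-suc : length (Q k ++ A (suc k) ++ P k) ≡ p + (a + ab + p)
  length-window-suc = trans (length-++ (Q k)) (cong₂ _+_ (length-reverse (P k)) length-A-suc++P)

  private
    mid  = centre k ∷ not (centre k) ∷ []
    mid′ = not (centre k) ∷ centre k ∷ []

  A-suc++A++P≡ : A (suc k) ++ A k ++ P k ≡ (P k ++ mid) ++ (Q k ++ power (A k) 2 ++ P k) ++ []
  A-suc++A++P≡ = begin
    A (suc k) ++ A k ++ P k                  ≡⟨ cong (_++ A k ++ P k) (A-suc k) ⟩
    (A k ++ B k ++ A k) ++ A k ++ P k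
      ≡⟨ solve 3 (λ a b p → (a ⊕ (b ⊕ a)) ⊕ (a ⊕ p) ⊜ (a ⊕ b) ⊕ (a ⊕ (a ⊕ p)))
           refl (A k) (B k) (P k) ⟩
    (A k ++ B k) ++ A k ++ A k ++ P k        ≡⟨ cong (_++ A k ++ A k ++ P k) (A++B≡P++centre k) ⟩
    (P k ++ mid ++ Q k) ++ A k ++ A k ++ P k
      ≡⟨ solve 4 (λ p x q a → (p ⊕ (x ⊕ q)) ⊕ (a ⊕ (a ⊕ p))
                             ⊜ (p ⊕ x) ⊕ ((q ⊕ ((a ⊕ (a ⊕ id)) ⊕ p)) ⊕ id))
           refl (P k) mid (Q k) (A k) ⟩
    (P k ++ mid) ++ (Q k ++ power (A k) 2 ++ P k) ++ [] ∎
    where open ≡-Reasoning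

  A-suc-suc≡ : A (suc (suc k)) ≡ (P k ++ mid) ++ (Q k ++ power (A k) 3 ++ P k) ++ (mid′ ++ Q k)
  A-suc-suc≡ = begin
    A (suc (suc k))                                  ≡⟨ A-suc (suc k) ⟩
    A (suc k) ++ B (suc k) ++ A (suc k)              ≡⟨ cong₂ (λ u v → u ++ v ++ u) (A-suc k) (B-suc k) ⟩
    (A k ++ B k ++ A k) ++ A k ++ (A k ++ B k ++ A k)
      ≡⟨ solve 2 (λ a b → (a ⊕ (b ⊕ a)) ⊕ (a ⊕ (a ⊕ (b ⊕ a)))
                         ⊜ (a ⊕ b) ⊕ (a ⊕ (a ⊕ (a ⊕ (b ⊕ a)))))
           refl (A k) (B k) ⟩
    (A k ++ B k) ++ A k ++ A k ++ A k ++ (B k ++ A k)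
      ≡⟨ cong₂ (λ u v → u ++ A k ++ A k ++ A k ++ v) (A++B≡P++centre k) (B++A≡P++centre k) ⟩
    (P k ++ mid ++ Q k) ++ A k ++ A k ++ A k ++ (P k ++ mid′ ++ Q k)
      ≡⟨ solve 5 (λ p x q a y → (p ⊕ (x ⊕ q)) ⊕ (a ⊕ (a ⊕ (a ⊕ (p ⊕ (y ⊕ q)))))
                             ⊜ (p ⊕ x) ⊕ ((q ⊕ ((a ⊕ (a ⊕ (a ⊕ id))) ⊕ p)) ⊕ (y ⊕ q)))
           refl (P k) mid (Q k) (A k) mid′ ⟩
    (P k ++ mid) ++ (Q k ++ power (A k) 3 ++ P k) ++ (mid′ ++ Q k) ∎
    where open ≡-Reasoning

  F-window : ∀ {z} → F k z →
    ∃ λ h → z ≡ suc p + h × PeriodicOn a (h + (p + 2)) (h + (p + 2) + (p + (2 * a + p)))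
  F-window z∈F with anchor k z∈F (subst (_< length (A (suc k))) (sym half-f-2k+1) suc-p<A-suc)
    where
    suc-p<A-suc : suc p < length (A (suc k))
    suc-p<A-suc = subst (suc p <_) (sym length-A-suc≡a+ab) (≤-rebalance {0} {a + p} z≤n (difference a p))
      where
      difference : ∀ a p → a + (2 + (p + p)) + 0 ≡ a + p + suc (suc p)
      difference = solve-∀
  ... | u , z≡ , occ = h , trans z≡ (cong (_+ h) half-f-2k+1) ,
    subst (λ E → PeriodicOn a (h + (p + 2)) (h + (p + 2) + E)) (length-window 2)
      (occursAt-periodicOn window (periodic-window k 2))
    where
    h = length (iter (suc k) u)
    window : OccursAt (h + (p + 2)) (Q k ++ power (A k) 2 ++ P k)
    window = subst (λ i → OccursAt (h + i) (Q k ++ power (A k) 2 ++ P k)) (length-++ (P k))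
      (occursAt-infix (P k ++ mid) _ [] A-suc++A++P≡ (occursAt-++ʳ (iter (suc k) u) _ occ))

  E′-suc-window : ∀ {z} → E′ (suc k) z →
    ∃ λ h → z ≡ a + ab + (a + suc p) + h × PeriodicOn a (h + (p + 2)) (h + (p + 2) + (p + (3 * a + p)))
  E′-suc-window z∈E′ with anchor (suc k) z∈E′ (subst (_< length (A (suc (suc k)))) (sym half-f-2k+5) Φ<A)
    where
    Φ<A : a + ab + (a + suc p) < length (A (suc (suc k)))
    Φ<A = subst (a + ab + (a + suc p) <_) (sym length-A-suc-suc) (≤-rebalance {0} {a + p} z≤n (difference a p))
      where
      difference : ∀ a p → a + (2 + (p + p)) + (a + (a + (2 + (p + p)))) + 0
                     ≡ a + p + suc (a + (2 + (p + p)) + (a + suc p))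
      difference = solve-∀
  ... | u , z≡ , occ = h , trans z≡ (cong (_+ h) half-f-2k+5) ,
    subst (λ E → PeriodicOn a (h + (p + 2)) (h + (p + 2) + E)) (length-window 3)
      (occursAt-periodicOn window (periodic-window k 3))
    where
    h = length (iter (suc (suc k)) u)
    window : OccursAt (h + (p + 2)) (Q k ++ power (A k) 3 ++ P k)
    window = subst (λ i → OccursAt (h + i) (Q k ++ power (A k) 3 ++ P k)) (length-++ (P k))
      (occursAt-infix (P k ++ mid) _ (mid′ ++ Q k) A-suc-suc≡
        (occursAt-++ˡ (A (suc (suc k))) _ (occursAt-++ʳ (iter (suc (suc k)) u) _ occ)))

  occursAt-A-suc++P : ∀ {i} → OccursAt i (A (suc k) ++ A k ++ P k) → OccursAt i (A (suc k) ++ P k)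
  occursAt-A-suc++P {i} occ with P-prefix k
  ... | Z , A≡PZ = occursAt-++ˡ (A (suc k) ++ P k) (Z ++ P k) (subst (OccursAt i) regroup occ)
    where
    regroup : A (suc k) ++ A k ++ P k ≡ (A (suc k) ++ P k) ++ Z ++ P k
    regroup = trans (cong (λ w → A (suc k) ++ w ++ P k) A≡PZ)
      (solve 3 (λ a p z → a ⊕ ((p ⊕ z) ⊕ p) ⊜ (a ⊕ p) ⊕ (z ⊕ p)) refl (A (suc k)) (P k) Z)

  occursAt-window-suc : ∀ {t} → OccursAt t (A k ++ A (suc k) ++ A k ++ P k) →
    ∃ λ μ → μ + p ≡ a × OccursAt (t + μ) (Q k ++ A (suc k) ++ P k)
  occursAt-window-suc occ with Q-suffix k | P-prefix k
  ... | M , A≡MQ | Z , A≡PZ = length M , μ+p≡a , occursAt-infix M _ (Z ++ P k) regroup occ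
    where
    μ+p≡a : length M + p ≡ a
    μ+p≡a = sym (trans (cong length A≡MQ) (trans (length-++ M) (cong (length M +_) (length-reverse (P k)))))
    regroup : A k ++ A (suc k) ++ A k ++ P k ≡ M ++ (Q k ++ A (suc k) ++ P k) ++ Z ++ P k
    regroup = trans (cong₂ (λ u w → u ++ A (suc k) ++ w ++ P k) A≡MQ A≡PZ)
      (solve 5 (λ m q a p z → (m ⊕ q) ⊕ (a ⊕ ((p ⊕ z) ⊕ p)) ⊜ m ⊕ ((q ⊕ (a ⊕ p)) ⊕ (z ⊕ p)))
         refl M (Q k) (A (suc k)) (P k) Z)

  -- L = 0 when the digits above index 2k+2 vanish; otherwise the window starts p letters before h.
  E′-window : ∀ {z} → E′ k z →
    ∃ λ h → z ≡ a + suc p + h × ∃ λ L → (0 < L → L + p ≤ h) × PeriodicOn ab L (h + (a + ab + p))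
  E′-window z∈E′ with anchor k z∈E′ (subst (_< length (A (suc k))) (sym half-f-2k+3) Φ<A)
    where
    Φ<A : a + suc p < length (A (suc k))
    Φ<A = subst (a + suc p <_) (sym length-A-suc≡a+ab) (≤-rebalance {0} {p} z≤n (difference a p))
      where
      difference : ∀ a p → a + (2 + (p + p)) + 0 ≡ p + suc (a + suc p)
      difference = solve-∀
  ... | [] , z≡ , occ = 0 , trans z≡ (cong₂ _+_ half-f-2k+3 (cong length (iter-[] (suc k)))) , 0 , (λ ()) ,
    subst (PeriodicOn ab 0) length-A-suc++P (occursAt-periodicOn (occursAt-A-suc++P at-0) (periodic-A-suc++P k))
    where
    at-0 : OccursAt 0 (A (suc k) ++ A k ++ P k)
    at-0 = subst (λ i → OccursAt i (A (suc k) ++ A k ++ P k)) (cong length (iter-[] (suc k)))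
      (occursAt-++ʳ (iter (suc k) []) _ occ)
  ... | v ∷ W , z≡ , occ with iter-suc-ends-with-A k v W
  ... | T , iter≡ with occursAt-window-suc (occursAt-++ʳ T _ (subst (OccursAt 0) regroup occ))
    where
    regroup : iter (suc k) (v ∷ W) ++ A (suc k) ++ A k ++ P k ≡ T ++ A k ++ A (suc k) ++ A k ++ P k
    regroup = trans (cong (_++ A (suc k) ++ A k ++ P k) iter≡) (++-assoc T (A k) _)
  ... | μ , μ+p≡a , window = h , trans z≡ (cong (_+ h) half-f-2k+3) , L , (λ _ → ≤-reflexive L+p≡h) ,
    subst (PeriodicOn ab L) end≡ (occursAt-periodicOn window (periodic-window-suc k))
    where
    open ≡-Reasoning
    h = length (iter (suc k) (v ∷ W))
    L = length T + μ
    L+p≡h : L + p ≡ h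
    L+p≡h = begin
      length T + μ + p    ≡⟨ +-assoc (length T) μ p ⟩
      length T + (μ + p)  ≡⟨ cong (length T +_) μ+p≡a ⟩
      length T + a        ≡⟨ sym (length-++ T) ⟩
      length (T ++ A k)   ≡⟨ cong length (sym iter≡) ⟩
      h ∎
    end≡ : L + length (Q k ++ A (suc k) ++ P k) ≡ h + (a + ab + p)
    end≡ = begin
      L + length (Q k ++ A (suc k) ++ P k)  ≡⟨ cong (L +_) length-window-suc ⟩
      L + (p + (a + ab + p))                ≡⟨ sym (+-assoc L p _) ⟩
      L + p + (a + ab + p)                  ≡⟨ cong (_+ (a + ab + p)) L+p≡h ⟩
      h + (a + ab + p) ∎

  1≤a : 1 ≤ a
  1≤a = ≤-trans (s≤s z≤n) (length-A≥ k)

  vanish-F-window : ∀ m n z h → z ≡ suc p + h →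
    PeriodicOn a (h + (p + 2)) (h + (p + 2) + (p + (2 * a + p))) →
    f (2 * k) + 1 ≤ n → n + 1 < f (2 * k + 2) →
    z + f (2 * k) + 1 < n + m → n + m + 1 ≤ z + f (2 * k) + f (2 * k + 1) → H m n ≡ 0ℤ
  vanish-F-window m n _ h refl periodic rewrite f-even k | f-2k+1 | f-2k+2 =
    λ a+1≤n n+1<A z+a+1<n+m n+m+1≤z+a+ab →
    H-periodicOn m n 1≤a a+1≤n (≤-rebalance n+m+1≤z+a+ab (last-row-fits a p h m n))
      (λ _ → ≤-rebalance z+a+1<n+m (late-row-starts a p h m n) , ≤-rebalance n+1<A (late-row-fits a p h m n))
      periodic
    where
    last-row-fits : ∀ a p h m n →
      h + (p + 2) + (p + (2 * a + p)) + (n + m + 1) ≡ suc p + h + a + (2 + (p + p)) + (m + n + a)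
    last-row-fits = solve-∀
    late-row-starts : ∀ a p h m n → n + m + suc (suc p + h + a + 1) ≡ n + m + suc (h + (p + 2) + a)
    late-row-starts = solve-∀
    late-row-fits : ∀ a p h m n →
      h + (p + 2) + (p + (2 * a + p)) + suc (n + 1) ≡ a + (2 + (p + p)) + (h + (p + 2) + n + a)
    late-row-fits = solve-∀

  vanish-F : ∀ m n z → F k z →
    f (2 * k) + 1 ≤ n → n + 1 < f (2 * k + 2) →
    z + f (2 * k) + 1 < n + m → n + m + 1 ≤ z + f (2 * k) + f (2 * k + 1) → H m n ≡ 0ℤ
  vanish-F m n z z∈F = let h , z≡ , periodic = F-window z∈F in vanish-F-window m n z h z≡ periodic

  vanish-E′-suc-window : ∀ m n z h → z ≡ a + ab + (a + suc p) + h →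
    PeriodicOn a (h + (p + 2)) (h + (p + 2) + (p + (3 * a + p))) →
    f (2 * k) + 1 ≤ n → n + 1 < f (2 * k + 3) →
    z + 1 < n + m + f (2 * k + 2) → n + m + 1 ≤ z → H m n ≡ 0ℤ
  vanish-E′-suc-window m n _ h refl periodic rewrite f-even k | f-2k+2 | f-2k+3 =
    λ a+1≤n n+1<A z+1<n+m+A n+m+1≤z →
    H-periodicOn m n 1≤a a+1≤n (≤-rebalance n+m+1≤z (last-row-fits a p h m n))
      (λ _ → ≤-rebalance z+1<n+m+A (late-row-starts a p h m n) , ≤-rebalance n+1<A (late-row-fits a p h m n))
      periodic
    where
    last-row-fits : ∀ a p h m n →
      h + (p + 2) + (p + (3 * a + p)) + (n + m + 1) ≡ a + (2 + (p + p)) + (a + suc p) + h + (m + n + a)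
    last-row-fits = solve-∀
    late-row-starts : ∀ a p h m n →
      n + m + suc (a + (2 + (p + p)) + (a + suc p) + h + 1) ≡ n + m + (a + (2 + (p + p))) + suc (h + (p + 2) + a)
    late-row-starts = solve-∀
    late-row-fits : ∀ a p h m n →
      h + (p + 2) + (p + (3 * a + p)) + suc (n + 1) ≡ a + (2 + (p + p)) + a + (h + (p + 2) + n + a)
    late-row-fits = solve-∀

  vanish-E′-suc : ∀ m n z → E′ (suc k) z →
    f (2 * k) + 1 ≤ n → n + 1 < f (2 * k + 3) →
    z + 1 < n + m + f (2 * k + 2) → n + m + 1 ≤ z → H m n ≡ 0ℤ
  vanish-E′-suc m n z z∈E′ = let h , z≡ , periodic = E′-suc-window z∈E′ in
    vanish-E′-suc-window m n z h z≡ periodic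

  vanish-E′-window : ∀ m n z h L → z ≡ a + suc p + h → (0 < L → L + p ≤ h) →
    PeriodicOn ab L (h + (a + ab + p)) →
    f (2 * k + 1) + 1 ≤ n → n + 1 < f (2 * k + 2) →
    z + 1 < n + m + f (2 * k) → n + m + 1 ≤ z → H m n ≡ 0ℤ
  vanish-E′-window m n _ h L refl late periodic rewrite f-even k | f-2k+1 | f-2k+2 =
    λ ab+1≤n n+1<A z+1<n+m+a n+m+1≤z →
    H-periodicOn m n (s≤s z≤n) ab+1≤n (≤-rebalance n+m+1≤z (last-row-fits a p h m n))
      (λ m<L → let L+p≤h = late (≤-trans (s≤s z≤n) m<L) in
        ≤-trans (≤-reflexive (late-row-start L p)) (≤-trans (+-monoˡ-≤ (p + 3) L+p≤h)
          (≤-rebalance z+1<n+m+a (h-bound a p h m n))) ,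
        ≤-trans (≤-reflexive (late-row-end L n p)) (+-mono-≤ L+p≤h (+-monoˡ-≤ p n+1<A)))
      periodic
    where
    last-row-fits : ∀ a p h m n →
      h + (a + (2 + (p + p)) + p) + (n + m + 1) ≡ a + suc p + h + (m + n + (2 + (p + p)))
    last-row-fits = solve-∀
    h-bound : ∀ a p h m n → n + m + suc (a + suc p + h + 1) ≡ n + m + a + (h + (p + 3))
    h-bound = solve-∀
    late-row-start : ∀ L p → suc (L + (2 + (p + p))) ≡ L + p + (p + 3)
    late-row-start = solve-∀
    late-row-end : ∀ L n p → L + n + (2 + (p + p)) ≡ L + p + (suc (n + 1) + p)
    late-row-end = solve-∀

  vanish-E′ : ∀ m n z → E′ k z →
    f (2 * k + 1) + 1 ≤ n → n + 1 < f (2 * k + 2) →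
    z + 1 < n + m + f (2 * k) → n + m + 1 ≤ z → H m n ≡ 0ℤ
  vanish-E′ m n z z∈E′ = let h , z≡ , L , late , periodic = E′-window z∈E′ in
    vanish-E′-window m n z h L z≡ late periodic

enumerates-∈ : ∀ {S e} → Enumerates S e → ∀ i → S (e i)
enumerates-∈ (_ , covers) i = proj₂ (covers _) (i , refl)

-- Imported only here, since +_ makes sections such as (a +_) ambiguous.
open import Data.Integer using (+_)

lemma6 : (k : ℕ) (α β′ γ : ℕ → ℕ) →
  Enumerates (E′ (suc k)) α → Enumerates (F″ k) β′ → Enumerates (E′ k) γ →
  (∀ m n i → 1 ≤ n →
    f (2 * k) + 1 ≤ n → n + 1 < f (2 * k + 2) →
    β′ i + f (2 * k) + 1 < n + m → n + m + 1 ≤ β′ i + f (2 * k) + f (2 * k + 1) →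
    H m n ≡ + 0)
  ×
  (∀ m n i → 1 ≤ n →
    f (2 * k + 1) + 1 ≤ n → n + 1 < f (2 * k + 2) →
    γ i + 1 < n + m + f (2 * k) → n + m + 1 ≤ γ i →
    H m n ≡ + 0)
  ×
  (∀ m n i → 1 ≤ n →
    f (2 * k) + 1 ≤ n → n + 1 < f (2 * k + 3) →
    α i + 1 < n + m + f (2 * k + 2) → n + m + 1 ≤ α i →
    H m n ≡ + 0)
lemma6 k α β′ γ enα enβ′ enγ =
  (λ m n i _ → vanish-F k m n (β′ i) (proj₁ (enumerates-∈ enβ′ i))) ,
  (λ m n i _ → vanish-E′ k m n (γ i) (enumerates-∈ enγ i)) ,
  (λ m n i _ → vanish-E′-suc k m n (α i) (enumerates-∈ enα i))
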